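{- Let $n\ge 2$. Let $\mathfrak P_n$ be the pipeline elementary Petri net with places $p_1,\dots,p_{n-1}$ and transitions $t_1,\dots,t_n$, where $pre(t_1)=\emptyset$, $post(t_1)=\{p_1\}$, $pre(t_i)=\{p_{i-1}\}$ and $post(t_i)=\{p_i\}$ for $2\le i\le n-1$, $pre(t_n)=\{p_{n-1}\}$, $post(t_n)=\emptyset$. Let $\mathcal N_n$ be the net obtained from $\mathfrak P_n$ by deleting the transition $t_1$, and $\mathcal N'_n$ the net obtained from $\mathfrak P_n$ by deleting the transition $t_2$. Take for each of these nets the state set $S=\{0,1\}^{\{p_1,\dots,p_{n-1}\}}$ of all markings and the order $t_1<t_2<\cdots<t_n$ on transitions, and form the semicubical sets $Q(\mathfrak P_n)$, $Q(\mathcal N_n)$, $Q(\mathcal N'_n)$. Then $Q(\mathcal N_n)$ and $Q(\mathcal N'_n)$ are semicubical subsets of $Q(\mathfrak P_n)$, $Q(\mathfrak P_n)=Q(\mathcal N_n)\cup Q(\mathcal N'_n)$, and the intersection $Q(\mathcal N_n)\cap Q(\mathcal N'_n)$ is a semicubical set with two components, each isomorphic to $Q(\mathcal N_{n-1})$.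
   Context: An elementary Petri net consists of places $P$, transitions $E$ and maps $pre,post$ from $E$ to subsets of $P$. For a marking $s\subseteq P$ and $a\in E$, $s\cdot a$ is defined iff $pre(a)\subseteq s$ and $(s\setminus pre(a))\cap post(a)=\emptyset$, and then $s\cdot a=(s\setminus pre(a))\cup post(a)$; this extends to a partial right action of the trace monoid $M(E,I)$ (generated by $E$ with relations $ab=ba$ for $(a,b)\in I$), where $(a,b)\in I$ iff $(pre(a)\cup post(a))\cap(pre(b)\cup post(b))=\emptyset$. For a state set $S$ and a linear order on $E$, the semicubical set $Q(S,E,I)$ has $Q_m=\{(s,a_1,\dots,a_m)\in S\times E^m : a_1<\dots<a_m,\ s\cdot a_1\cdots a_m\in S \text{ is defined},\ (a_i,a_j)\in I \text{ for all } i<j\}$ and boundary maps $\partial_i^{m,\varepsilon}(s,a_1,\dots,a_m)=(s\cdot a_i^{\varepsilon},a_1,\dots,a_{i-1},a_{i+1},\dots,a_m)$ with $a_i^0=1$, $a_i^1=a_i$. A semicubical set is a family of sets $X_m$ with maps $\partial_i^{m,\varepsilon}:X_m\to X_{m-1}$ ($1\le i\le m$, $\varepsilon\in\{0,1\}$) satisfying $\partial_i^{m-1,\alpha}\partial_j^{m,\beta}=\partial_{j-1}^{m-1,\beta}\partial_i^{m,\alpha}$ for $i<j$; semicubical subsets are levelwise subsets closed under the boundary maps, and unions/intersections are levelwise. $\mathcal N_{m}$ denotes the net with places $p_1,\dots,p_{m-1}$ and transitions $t_2,\dots,t_m$ with $pre(t_i)=\{p_{i-1}\}$, $post(t_i)=\{p_i\}$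 for $i<m$, $post(t_m)=\emptyset$ (for $m=1$: no places and no transitions), with all markings as states; the isomorphism with components is up to relabeling of places and transitions. -}

module Defs where

open import Data.Nat using (ℕ; zero; suc; _∸_; _≡ᵇ_)
open import Data.Bool using (Bool; true; false; if_then_else_)
open import Data.Fin using (Fin; toℕ) renaming (_<_ to _<ᶠ_; zero to fzero; suc to fsuc)
open import Data.Fin.Subset using (Subset; _⊆_; _∪_; _∩_; _─_; Empty)
open import Data.Vec using (Vec; []; _∷_; lookup; removeAt; map; tabulate)
open import Data.Product using (Σ; ∃; _×_; _,_; proj₁)
open import Data.Sum using (_⊎_)
open import Data.Empty using (⊥)
open import Relation.Binary.PropositionalEquality using (_≡_; _≢_)

record Net : Set₁ where
  field
    k    : ℕ
    T    : Set
    _<T_ : T → T → Set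
    pre  : T → Subset k
    post : T → Subset k

module _ (N : Net) where
  open Net N

  Marking : Set
  Marking = Subset k

  Indep : T → T → Set
  Indep a b = Empty ((pre a ∪ post a) ∩ (pre b ∪ post b))

  -- total formula for (s \ pre a) ∪ post a; agrees with s · a when defined
  act : Marking → T → Marking
  act s a = (s ─ pre a) ∪ post a

  Fires : Marking → T → Marking → Set
  Fires s a s' = (pre a ⊆ s) × Empty ((s ─ pre a) ∩ post a) × (s' ≡ act s a)

  data Run : {m : ℕ} → Marking → Vec T m → Marking → Set where
    run-[] : ∀ {s} → Run s [] s
    run-∷  : ∀ {m s s' s''} {a : T} {as : Vec T m} →
             Fires s a s' → Run s' as s'' → Run s (a ∷ as) s''

  Raw : ℕ → Set
  Raw m = Marking × Vec T m

  -- raw boundary maps ∂ᵢ^ε, i 0-based (i = 0 is ∂₁); ε = false is a^0 = 1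
  ∂ : ∀ {m} → Fin (suc m) → Bool → Raw (suc m) → Raw m
  ∂ i ε (s , as) = (if ε then act s (lookup as i) else s) , removeAt as i

  Q : (m : ℕ) → Raw m → Set
  Q m (s , as) =
    ((i j : Fin m) → i <ᶠ j → (lookup as i <T lookup as j) × Indep (lookup as i) (lookup as j))
    × ∃ (λ s' → Run s as s')

  GSub : Set₁
  GSub = (m : ℕ) → Raw m → Set

  Closed : GSub → Set
  Closed A = ∀ {m} (x : Raw (suc m)) (i : Fin (suc m)) (ε : Bool) → A (suc m) x → A m (∂ i ε x)

  IsSemicubicalSubset : GSub → GSub → Set
  IsSemicubicalSubset A B = (∀ m x → A m x → B m x) × Closed A

  Cell : Set
  Cell = Σ ℕ Raw

  data Conn (A : GSub) : Cell → Cell → Set where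
    c-refl  : ∀ {c} → Conn A c c
    c-sym   : ∀ {c d} → Conn A c d → Conn A d c
    c-trans : ∀ {c d e} → Conn A c d → Conn A d e → Conn A c e
    c-step  : ∀ {m} (x : Raw (suc m)) (i : Fin (suc m)) (ε : Bool) →
              A (suc m) x → Conn A (m , ∂ i ε x) (suc m , x)

  Connected : GSub → Set
  Connected A = (∃ λ m → ∃ λ x → A m x) ×
                (∀ m n (x : Raw m) (y : Raw n) → A m x → A n y → Conn A (m , x) (n , y))

-- isomorphism of semicubical sets A ⊆ raw cells of N and B ⊆ raw cells of N'
-- (both assumed closed under boundaries): levelwise bijection commuting with ∂
record Iso (N N' : Net) (A : GSub N) (B : GSub N') : Set where
  field
    to   : ∀ m → Σ (Raw N m) (A m) → Σ (Raw N' m) (B m)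
    from : ∀ m → Σ (Raw N' m) (B m) → Σ (Raw N m) (A m)
    from-to : ∀ m x → proj₁ (from m (to m x)) ≡ proj₁ x
    to-from : ∀ m y → proj₁ (to m (from m y)) ≡ proj₁ y
    to-∂ : ∀ m (x : Raw N (suc m)) (i : Fin (suc m)) (ε : Bool)
           (ax : A (suc m) x) (ax' : A m (∂ N i ε x)) →
           proj₁ (to m (∂ N i ε x , ax')) ≡ ∂ N' i ε (proj₁ (to (suc m) (x , ax)))

-- The pipeline net 𝔓ₙ: places p₁..p_{n-1} (index j ↦ p_{j+1}),
-- transitions t₁..tₙ (index j ↦ t_{j+1}), order t₁ < ⋯ < tₙ.
-- pre(t_{j+1}) = {p_j} (empty for j = 0), post(t_{j+1}) = {p_{j+1}} (empty for j = n-1).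

Pipe : ℕ → Net
Pipe n = record
  { k    = n ∸ 1
  ; T    = Fin n
  ; _<T_ = _<ᶠ_
  ; pre  = λ t → tabulate (λ p → toℕ t ≡ᵇ suc (toℕ p))
  ; post = λ t → tabulate (λ p → toℕ t ≡ᵇ toℕ p)
  }

Delete : (N : Net) → Net.T N → Net
Delete N t = record
  { k    = k
  ; T    = Σ T (λ u → u ≢ t)
  ; _<T_ = λ a b → proj₁ a <T proj₁ b
  ; pre  = λ a → pre (proj₁ a)
  ; post = λ a → post (proj₁ a)
  }
  where open Net N

incl : (N : Net) (t : Net.T N) {m : ℕ} → Raw (Delete N t) m → Raw N m
incl N t (s , as) = s , map proj₁ as

ImQ : (N : Net) (t : Net.T N) → GSub N
ImQ N t m x = ∃ λ y → Q (Delete N t) m y × incl N t y ≡ x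

𝒩 : ℕ → Net
𝒩 n = Delete (Pipe (suc n)) fzero    -- this is 𝒩_{n+1}

-- Faces of cells are cells because
-- independent transitions commute, which is a check place by place.  Since t₁ and t₂ both touch
-- p₁ they are never independent, so every cell of Q(𝔓ₙ) avoids t₁ or t₂, i.e. comes from Q(𝒩ₙ)
-- or from Q(𝒩'ₙ).  A cell avoiding both never touches p₁, so the intersection splits according
-- to the token on p₁, and dropping p₁ identifies each half with Q(𝒩_{n-1}).  Each half is
-- connected: every cell is joined to its initial vertex, and every marking of 𝒩_{n-1} can be
-- emptied by pushing its tokens out along the pipeline.
module Submission where

open import Defs
open import Data.Bool using (Bool; true; false; not; _∧_; _∨_)
open import Data.Bool.Properties using (∧-zeroʳ; ∧-identityʳ)
open import Data.Empty using (⊥; ⊥-elim)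
open import Data.Fin using (Fin; punchIn; _≟_)
  renaming (zero to fzero; suc to fsuc; _<_ to _<ᶠ_)
open import Data.Fin.Properties using (any?; <-cmp; punchIn-mono-≤; punchIn-injective; ≤∧≢⇒<; <⇒≢)
open import Data.Fin.Subset using (Subset; _⊆_; _∪_; _∩_; _─_; Empty) renaming (⊥ to ∅)
open import Data.Fin.Subset.Properties using (∩-comm; drop-∷-Empty)
open import Data.Nat using (ℕ; zero; suc; z≤n; s≤s; s<s⁻¹)
open import Data.Nat.Properties using (<⇒≤)
open import Data.Product using (Σ; ∃; _×_; _,_; proj₁; proj₂)
open import Data.Sum using (_⊎_; inj₁; inj₂)
open import Data.Vec using (Vec; []; _∷_; lookup; removeAt; map; tabulate; head; tail; here; there)
open import Data.Vec.Properties
  using (lookup-map; lookup-zipWith; lookup∘tabulate; lookup-replicate; tabulate∘lookup; tabulate-cong;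
         []=⇒lookup; lookup⇒[]=; map-∘; map-cong)
open import Relation.Binary.Construct.Closure.ReflexiveTransitive as Star using (Star; _◅_; _◅◅_; gmap)
open import Relation.Binary.Definitions using (tri<; tri≈; tri>)
open import Relation.Binary.PropositionalEquality
  using (_≡_; _≢_; refl; sym; trans; cong; cong₂; subst; subst₂; module ≡-Reasoning)
open import Function using (_∘_)
open import Relation.Nullary using (¬_; yes; no)

lookup-ext : ∀ {A : Set} {n} {xs ys : Vec A n} → (∀ i → lookup xs i ≡ lookup ys i) → xs ≡ ys
lookup-ext {xs = xs} {ys} eq = trans (sym (tabulate∘lookup xs)) (trans (tabulate-cong eq) (tabulate∘lookup ys))

lookup-removeAt : ∀ {A : Set} {m} (xs : Vec A (suc m)) i j →
                  lookup (removeAt xs i) j ≡ lookup xs (punchIn i j)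
lookup-removeAt (x ∷ xs)     fzero    j        = refl
lookup-removeAt (x ∷ y ∷ xs) (fsuc i) fzero    = refl
lookup-removeAt (x ∷ y ∷ xs) (fsuc i) (fsuc j) = lookup-removeAt (y ∷ xs) i j

map-removeAt : ∀ {A B : Set} {m} (f : A → B) (xs : Vec A (suc m)) i →
               removeAt (map f xs) i ≡ map f (removeAt xs i)
map-removeAt f (x ∷ xs)     fzero    = refl
map-removeAt f (x ∷ y ∷ xs) (fsuc i) = cong (f x ∷_) (map-removeAt f (y ∷ xs) i)

punchIn-mono-< : ∀ {m} (i : Fin (suc m)) (j k : Fin m) → j <ᶠ k → punchIn i j <ᶠ punchIn i k
punchIn-mono-< i j k j<k =
  ≤∧≢⇒< (punchIn-mono-≤ i j k (<⇒≤ j<k)) (λ eq → <⇒≢ j<k (punchIn-injective i j k eq))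

restrict : ∀ {A : Set} {P : A → Set} {m} (xs : Vec A m) → (∀ i → P (lookup xs i)) → Vec (Σ A P) m
restrict []       p = []
restrict {P = P} (x ∷ xs) p = (x , p fzero) ∷ restrict {P = P} xs (λ i → p (fsuc i))

map-proj₁-restrict : ∀ {A : Set} {P : A → Set} {m} (xs : Vec A m) (p : ∀ i → P (lookup xs i)) →
                     map proj₁ (restrict {P = P} xs p) ≡ xs
map-proj₁-restrict []       p = refl
map-proj₁-restrict {P = P} (x ∷ xs) p = cong (x ∷_) (map-proj₁-restrict {P = P} xs (λ i → p (fsuc i)))

lookup-─ : ∀ {n} (p q : Subset n) i → lookup (p ─ q) i ≡ lookup p i ∧ not (lookup q i)
lookup-─ (x ∷ p) (true  ∷ q) fzero    = sym (∧-zeroʳ x)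
lookup-─ (x ∷ p) (false ∷ q) fzero    = sym (∧-identityʳ x)
lookup-─ (_ ∷ p) (_     ∷ q) (fsuc i) = lookup-─ p q i

⊆⇒lookup : ∀ {n} {p q : Subset n} → p ⊆ q → ∀ i → lookup p i ≡ true → lookup q i ≡ true
⊆⇒lookup {p = p} p⊆q i eq = []=⇒lookup (p⊆q (lookup⇒[]= i p eq))

lookup⇒⊆ : ∀ {n} {p q : Subset n} → (∀ i → lookup p i ≡ true → lookup q i ≡ true) → p ⊆ q
lookup⇒⊆ {q = q} sub {i} i∈p = lookup⇒[]= i q (sub i ([]=⇒lookup i∈p))

Empty⇒lookup : ∀ {n} {p : Subset n} → Empty p → ∀ i → lookup p i ≡ false
Empty⇒lookup {p = p} empty i with lookup p i in eq
... | true  = ⊥-elim (empty (i , lookup⇒[]= i p eq))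
... | false = refl

lookup⇒Empty : ∀ {n} {p : Subset n} → (∀ i → lookup p i ≡ false) → Empty p
lookup⇒Empty {p = p} none (i , i∈p) with trans (sym ([]=⇒lookup i∈p)) (none i)
... | ()

Empty-false∷ : ∀ {n} {p : Subset n} → Empty p → Empty (false ∷ p)
Empty-false∷ empty (fzero  , ())
Empty-false∷ empty (fsuc i , there i∈p) = empty (i , i∈p)

-- FiresAt s p q s′: at a place with token s, lying in pre a iff p and in post a iff q,
-- firing a is allowed and leaves token s′.
data FiresAt : Bool → Bool → Bool → Bool → Set where
  idle    : ∀ {s} → FiresAt s false false s
  consume : FiresAt true true false false
  produce : FiresAt false false true true
  loop    : FiresAt true true true true

firesAt⁺ : ∀ s p q → (p ≡ true → s ≡ true) → (s ∧ not p) ∧ q ≡ false → FiresAt s p q ((s ∧ not p) ∨ q)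
firesAt⁺ true  true  true  _      _  = loop
firesAt⁺ true  true  false _      _  = consume
firesAt⁺ true  false true  _      ()
firesAt⁺ true  false false _      _  = idle
firesAt⁺ false true  q     p⇒s    _  with p⇒s refl
... | ()
firesAt⁺ false false true  _      _  = produce
firesAt⁺ false false false _      _  = idle

firesAt⁻ : ∀ {s p q s′} → FiresAt s p q s′ →
           (p ≡ true → s ≡ true) × ((s ∧ not p) ∧ q ≡ false) × (s′ ≡ (s ∧ not p) ∨ q)
firesAt⁻ (idle {true})  = (λ ()) , refl , refl
firesAt⁻ (idle {false}) = (λ ()) , refl , refl
firesAt⁻ consume        = (λ _ → refl) , refl , refl
firesAt⁻ produce        = (λ ()) , refl , refl
firesAt⁻ loop           = (λ _ → refl) , refl , refl

-- At every place at most one of two independent transitions acts, so they commute.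
firesAt-swap : ∀ {s s₁ s₂ pa qa pb qb} → (pa ∨ qa) ∧ (pb ∨ qb) ≡ false →
               FiresAt s pa qa s₁ → FiresAt s₁ pb qb s₂ →
               ∃ λ s₁′ → FiresAt s pb qb s₁′ × FiresAt s₁′ pa qa s₂
firesAt-swap _  idle    g       = _ , g , idle
firesAt-swap _  f       idle    = _ , idle , f
firesAt-swap () consume produce
firesAt-swap () produce consume
firesAt-swap () produce loop
firesAt-swap () loop    consume
firesAt-swap () loop    loop

module _ (N : Net) where
  open Net N

  FiresPointwise : Marking N → T → Marking N → Set
  FiresPointwise s a s′ =
    ∀ x → FiresAt (lookup s x) (lookup (pre a) x) (lookup (post a) x) (lookup s′ x)

  lookup-act : ∀ s a x → lookup (act N s a) x ≡ (lookup s x ∧ not (lookup (pre a) x)) ∨ lookup (post a) x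
  lookup-act s a x =
    trans (lookup-zipWith _∨_ x (s ─ pre a) (post a)) (cong (_∨ lookup (post a) x) (lookup-─ s (pre a) x))

  lookup-contact : ∀ s a x →
    lookup ((s ─ pre a) ∩ post a) x ≡ (lookup s x ∧ not (lookup (pre a) x)) ∧ lookup (post a) x
  lookup-contact s a x =
    trans (lookup-zipWith _∧_ x (s ─ pre a) (post a)) (cong (_∧ lookup (post a) x) (lookup-─ s (pre a) x))

  fires⇒pointwise : ∀ {s a s′} → Fires N s a s′ → FiresPointwise s a s′
  fires⇒pointwise {s} {a} (pre⊆s , noContact , refl) x =
    subst (FiresAt _ _ _) (sym (lookup-act s a x))
      (firesAt⁺ _ _ _ (⊆⇒lookup pre⊆s x) (trans (sym (lookup-contact s a x)) (Empty⇒lookup noContact x)))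

  pointwise⇒fires : ∀ {s a s′} → FiresPointwise s a s′ → Fires N s a s′
  pointwise⇒fires {s} {a} fires =
    lookup⇒⊆ (λ x → proj₁ (firesAt⁻ (fires x))) ,
    lookup⇒Empty (λ x → trans (lookup-contact s a x) (proj₁ (proj₂ (firesAt⁻ (fires x))))) ,
    lookup-ext (λ x → trans (proj₂ (proj₂ (firesAt⁻ (fires x)))) (sym (lookup-act s a x)))

  Indep-sym : ∀ {a b} → Indep N a b → Indep N b a
  Indep-sym {a} {b} = subst Empty (∩-comm (pre a ∪ post a) (pre b ∪ post b))

  Indep⇒disjointAt : ∀ {a b} → Indep N a b → ∀ x →
    (lookup (pre a) x ∨ lookup (post a) x) ∧ (lookup (pre b) x ∨ lookup (post b) x) ≡ false
  Indep⇒disjointAt {a} {b} ind x = begin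
    (lookup (pre a) x ∨ lookup (post a) x) ∧ (lookup (pre b) x ∨ lookup (post b) x)
      ≡⟨ sym (cong₂ _∧_ (lookup-zipWith _∨_ x (pre a) (post a)) (lookup-zipWith _∨_ x (pre b) (post b))) ⟩
    lookup (pre a ∪ post a) x ∧ lookup (pre b ∪ post b) x
      ≡⟨ sym (lookup-zipWith _∧_ x (pre a ∪ post a) (pre b ∪ post b)) ⟩
    lookup ((pre a ∪ post a) ∩ (pre b ∪ post b)) x
      ≡⟨ Empty⇒lookup ind x ⟩
    false ∎
    where open ≡-Reasoning

  fires-swap : ∀ {s s₁ s₂ a b} → Indep N a b → Fires N s a s₁ → Fires N s₁ b s₂ →
               ∃ λ s₁′ → Fires N s b s₁′ × Fires N s₁′ a s₂
  fires-swap {s = s} {s₂ = s₂} {a = a} {b = b} ind f g =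
    tabulate middle ,
    pointwise⇒fires (λ x → subst (FiresAt _ _ _) (sym (lookup∘tabulate middle x)) (proj₁ (proj₂ (swap x)))) ,
    pointwise⇒fires (λ x → subst (λ s → FiresAt s _ _ _) (sym (lookup∘tabulate middle x)) (proj₂ (proj₂ (swap x))))
    where
    swap : ∀ x → ∃ λ t → FiresAt (lookup s x) (lookup (pre b) x) (lookup (post b) x) t
                        × FiresAt t (lookup (pre a) x) (lookup (post a) x) (lookup s₂ x)
    swap x = firesAt-swap (Indep⇒disjointAt ind x) (fires⇒pointwise f x) (fires⇒pointwise g x)
    middle : Fin k → Bool
    middle x = proj₁ (swap x)

  run-front : ∀ {m s s″} (as : Vec T (suc m)) (i : Fin (suc m)) →
              (∀ j → j <ᶠ i → Indep N (lookup as j) (lookup as i)) → Run N s as s″ →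
              ∃ λ s′ → Fires N s (lookup as i) s′ × Run N s′ (removeAt as i) s″
  run-front (a ∷ as)     fzero    ind (run-∷ f r) = _ , f , r
  run-front (a ∷ b ∷ as) (fsuc i) ind (run-∷ f r)
    with run-front (b ∷ as) i (λ j j<i → ind (fsuc j) (s≤s j<i)) r
  ... | _ , g , r′ with fires-swap (ind fzero (s≤s z≤n)) f g
  ...   | _ , g′ , f′ = _ , g′ , run-∷ f′ r′

  fires-run-swap : ∀ {m s s₁ s₂ a} (bs : Vec T m) → (∀ j → Indep N a (lookup bs j)) →
                   Fires N s a s₁ → Run N s₁ bs s₂ → ∃ λ s′ → Run N s bs s′ × Fires N s′ a s₂
  fires-run-swap []       ind f run-[]      = _ , run-[] , f
  fires-run-swap (b ∷ bs) ind f (run-∷ g r) with fires-swap (ind fzero) f g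
  ... | _ , g′ , f′ with fires-run-swap bs (λ j → ind (fsuc j)) f′ r
  ...   | _ , r′ , f″ = _ , run-∷ g′ r′ , f″

  run-back : ∀ {m s s″} (as : Vec T (suc m)) (i : Fin (suc m)) →
             (∀ j → i <ᶠ j → Indep N (lookup as i) (lookup as j)) → Run N s as s″ →
             ∃ λ s′ → Run N s (removeAt as i) s′ × Fires N s′ (lookup as i) s″
  run-back (a ∷ as)     fzero    ind (run-∷ f r) = fires-run-swap as (λ j → ind (fsuc j) (s≤s z≤n)) f r
  run-back (a ∷ b ∷ as) (fsuc i) ind (run-∷ f r)
    with run-back (b ∷ as) i (λ j i<j → ind (fsuc j) (s≤s i<j)) r
  ... | _ , r′ , g = _ , run-∷ f r′ , g

  -- The upper face ∂ᵢ¹ lets aᵢ fire first and the lower face ∂ᵢ⁰ lets it fire last;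
  -- independence from the other transitions of the cell makes both reorderings legal.
  Q-closed : Closed N (Q N)
  Q-closed (s , as) i ε (ordered , _ , r) = ordered′ , run′ ε
    where
    ordered′ : ∀ j k → j <ᶠ k →
               (lookup (removeAt as i) j <T lookup (removeAt as i) k)
               × Indep N (lookup (removeAt as i) j) (lookup (removeAt as i) k)
    ordered′ j k j<k rewrite lookup-removeAt as i j | lookup-removeAt as i k =
      ordered _ _ (punchIn-mono-< i j k j<k)
    run′ : ∀ ε → ∃ (Run N (proj₁ (∂ N i ε (s , as))) (removeAt as i))
    run′ true with run-front as i (λ j j<i → proj₂ (ordered j i j<i)) r
    ... | _ , (_ , _ , refl) , r′ = _ , r′
    run′ false with run-back as i (λ j i<j → proj₂ (ordered i j i<j)) r
    ... | _ , r′ , _ = _ , r′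

  Q-indep : ∀ {m s} {as : Vec T m} → Q N m (s , as) → ∀ {i j} → i ≢ j →
            Indep N (lookup as i) (lookup as j)
  Q-indep (ordered , _) {i} {j} i≢j with <-cmp i j
  ... | tri< i<j _   _   = proj₂ (ordered i j i<j)
  ... | tri≈ _   i≡j _   = ⊥-elim (i≢j i≡j)
  ... | tri> _   _   j<i = Indep-sym (proj₂ (ordered j i j<i))

module _ (N : Net) (t : Net.T N) where
  open Net N

  run-incl⁺ : ∀ {m s s′} {as : Vec (Net.T (Delete N t)) m} →
              Run (Delete N t) s as s′ → Run N s (map proj₁ as) s′
  run-incl⁺ run-[]      = run-[]
  run-incl⁺ (run-∷ f r) = run-∷ f (run-incl⁺ r)

  run-incl⁻ : ∀ {m s s′} (as : Vec (Net.T (Delete N t)) m) →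
              Run N s (map proj₁ as) s′ → Run (Delete N t) s as s′
  run-incl⁻ []       run-[]      = run-[]
  run-incl⁻ (a ∷ as) (run-∷ f r) = run-∷ f (run-incl⁻ as r)

  Q-incl⁺ : ∀ {m} (y : Raw (Delete N t) m) → Q (Delete N t) m y → Q N m (incl N t y)
  Q-incl⁺ (s , as) (ordered , s′ , r) = ordered′ , s′ , run-incl⁺ r
    where
    ordered′ : ∀ i j → i <ᶠ j → (lookup (map proj₁ as) i <T lookup (map proj₁ as) j)
                                × Indep N (lookup (map proj₁ as) i) (lookup (map proj₁ as) j)
    ordered′ i j i<j rewrite lookup-map i proj₁ as | lookup-map j proj₁ as = ordered i j i<j

  Q-incl⁻ : ∀ {m} (y : Raw (Delete N t) m) → Q N m (incl N t y) → Q (Delete N t) m y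
  Q-incl⁻ (s , as) (ordered , s′ , r) = ordered′ , s′ , run-incl⁻ as r
    where
    ordered′ : ∀ i j → i <ᶠ j → (proj₁ (lookup as i) <T proj₁ (lookup as j))
                                × Indep N (proj₁ (lookup as i)) (proj₁ (lookup as j))
    ordered′ i j i<j rewrite sym (lookup-map i proj₁ as) | sym (lookup-map j proj₁ as) = ordered i j i<j

  incl-∂ : ∀ {m} (y : Raw (Delete N t) (suc m)) i ε → incl N t (∂ (Delete N t) i ε y) ≡ ∂ N i ε (incl N t y)
  incl-∂ (s , as) i true rewrite lookup-map i proj₁ as =
    cong (act N s (proj₁ (lookup as i)) ,_) (sym (map-removeAt proj₁ as i))
  incl-∂ (s , as) i false = cong (s ,_) (sym (map-removeAt proj₁ as i))

  ImQ-isSemicubicalSubset : IsSemicubicalSubset N (ImQ N t) (Q N)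
  ImQ-isSemicubicalSubset =
    (λ { m x (y , q , refl) → Q-incl⁺ y q }) ,
    (λ { x i ε (y , q , refl) → ∂ (Delete N t) i ε y , Q-closed (Delete N t) y i ε q , incl-∂ y i ε })

  ImQ⁻ : ∀ {m s} {as : Vec T m} → ImQ N t m (s , as) → ∀ i → lookup as i ≢ t
  ImQ⁻ ((_ , bs) , _ , refl) i eq = proj₂ (lookup bs i) (trans (sym (lookup-map i proj₁ bs)) eq)

  ImQ⁺ : ∀ {m s} {as : Vec T m} → Q N m (s , as) → (∀ i → lookup as i ≢ t) → ImQ N t m (s , as)
  ImQ⁺ {m} {s} {as} q avoids =
    (s , bs) , Q-incl⁻ (s , bs) (subst (λ cs → Q N m (s , cs)) (sym map-bs) q) , cong (s ,_) map-bs
    where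
    bs : Vec (Net.T (Delete N t)) m
    bs = restrict as avoids
    map-bs : map proj₁ bs ≡ as
    map-bs = map-proj₁-restrict as avoids

-- Connectedness

Reachable : (N : Net) → Marking N → Marking N → Set
Reachable N = Star (λ s s′ → ∃ λ a → Fires N s a s′)

Conn-vertex : ∀ {N A} → Closed N A → ∀ {j} s (as : Vec (Net.T N) j) → A j (s , as) →
              Conn N A (j , (s , as)) (0 , (s , []))
Conn-vertex closed s []       _   = c-refl
Conn-vertex closed s (a ∷ as) x∈A =
  c-trans (c-sym (c-step (s , a ∷ as) fzero false x∈A))
          (Conn-vertex closed s as (closed (s , a ∷ as) fzero false x∈A))

Conn-edge : ∀ {N A s a} → A 1 (s , a ∷ []) → Conn N A (0 , (s , [])) (0 , (act N s a , []))
Conn-edge {s = s} {a} x∈A =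
  c-trans (c-step (s , a ∷ []) fzero false x∈A) (c-sym (c-step (s , a ∷ []) fzero true x∈A))

-- The pipeline

module Pipeline (m : ℕ) where

  P : Net
  P = Pipe (suc (suc m))

  t₁ t₂ : Fin (suc (suc m))
  t₁ = fzero
  t₂ = fsuc fzero

  t₁≢t₂ : t₁ ≢ t₂
  t₁≢t₂ ()

  t₁-t₂-dependent : ¬ Indep P t₁ t₂
  t₁-t₂-dependent empty = empty (fzero , here)

  Q-covered : ∀ j x → Q P j x → ImQ P t₁ j x ⊎ ImQ P t₂ j x
  Q-covered j (s , as) q with any? (λ i → lookup as i ≟ t₁)
  ... | no  t₁∉as      = inj₁ (ImQ⁺ P t₁ q (λ i eq → t₁∉as (i , eq)))
  ... | yes (i , as[i]≡t₁) = inj₂ (ImQ⁺ P t₂ q t₂∉as)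
    where
    t₂∉as : ∀ k → lookup as k ≢ t₂
    t₂∉as k as[k]≡t₂ =
      t₁-t₂-dependent (subst₂ (Indep P) as[i]≡t₁ as[k]≡t₂
        (Q-indep P q λ { refl → t₁≢t₂ (trans (sym as[i]≡t₁) as[k]≡t₂) }))

  shift : Net.T (𝒩 m) → Fin (suc (suc m))
  shift (u , _) = fsuc u

  shift≢t₁ : ∀ a → shift a ≢ t₁
  shift≢t₁ a ()

  shift≢t₂ : ∀ a → shift a ≢ t₂
  shift≢t₂ (fzero , u≢0) refl = u≢0 refl

  shift-injective : ∀ {a a′} → shift a ≡ shift a′ → a ≡ a′
  shift-injective {u , _} {.u , _} refl = refl

  unshift : (a : Fin (suc (suc m))) → a ≢ t₁ × a ≢ t₂ → Net.T (𝒩 m)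
  unshift fzero            (a≢t₁ , _)    = ⊥-elim (a≢t₁ refl)
  unshift (fsuc fzero)     (_    , a≢t₂) = ⊥-elim (a≢t₂ refl)
  unshift (fsuc (fsuc c))  _             = fsuc c , λ ()

  shift-unshift : ∀ a (avoids : a ≢ t₁ × a ≢ t₂) → shift (unshift a avoids) ≡ a
  shift-unshift fzero           (a≢t₁ , _)    = ⊥-elim (a≢t₁ refl)
  shift-unshift (fsuc fzero)    (_    , a≢t₂) = ⊥-elim (a≢t₂ refl)
  shift-unshift (fsuc (fsuc c)) _             = refl

  -- A shifted transition never touches p₁, and acts on the other places as in 𝒩_{n-1}.
  fires-shift⁺ : ∀ a b {t t′} → Fires (𝒩 m) t a t′ → Fires P (b ∷ t) (shift a) (b ∷ t′)
  fires-shift⁺ (fzero  , 0≢0) b f = ⊥-elim (0≢0 refl)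
  fires-shift⁺ a@(fsuc c , _) b f =
    pointwise⇒fires P {a = shift a} λ { fzero → idle ; (fsuc x) → fires⇒pointwise (𝒩 m) {a = a} f x }

  fires-shift⁻ : ∀ a {b b′ t t′} → Fires P (b ∷ t) (shift a) (b′ ∷ t′) → b ≡ b′ × Fires (𝒩 m) t a t′
  fires-shift⁻ (fzero  , 0≢0) f = ⊥-elim (0≢0 refl)
  fires-shift⁻ a@(fsuc c , _) f with fires⇒pointwise P {a = shift a} f fzero
  ... | idle = refl , pointwise⇒fires (𝒩 m) {a = a} (λ x → fires⇒pointwise P {a = shift a} f (fsuc x))

  Indep-shift⁺ : ∀ a a′ → Indep (𝒩 m) a a′ → Indep P (shift a) (shift a′)
  Indep-shift⁺ (fzero  , 0≢0) a′            ind = ⊥-elim (0≢0 refl)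
  Indep-shift⁺ (fsuc c , _)   (fzero , 0≢0) ind = ⊥-elim (0≢0 refl)
  Indep-shift⁺ (fsuc c , _)   (fsuc d , _)  ind = Empty-false∷ ind

  Indep-shift⁻ : ∀ a a′ → Indep P (shift a) (shift a′) → Indep (𝒩 m) a a′
  Indep-shift⁻ (fzero  , 0≢0) a′            ind = ⊥-elim (0≢0 refl)
  Indep-shift⁻ (fsuc c , _)   (fzero , 0≢0) ind = ⊥-elim (0≢0 refl)
  Indep-shift⁻ (fsuc c , _)   (fsuc d , _)  ind = drop-∷-Empty ind

  act-shift : ∀ b t a → act P (b ∷ t) (shift a) ≡ b ∷ act (𝒩 m) t a
  act-shift b     t (fzero  , 0≢0) = ⊥-elim (0≢0 refl)
  act-shift true  t (fsuc c , _)   = refl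
  act-shift false t (fsuc c , _)   = refl

  run-shift⁺ : ∀ {j} b {t t′} {as : Vec (Net.T (𝒩 m)) j} →
               Run (𝒩 m) t as t′ → Run P (b ∷ t) (map shift as) (b ∷ t′)
  run-shift⁺ b run-[]                 = run-[]
  run-shift⁺ b (run-∷ {a = a} f r) = run-∷ (fires-shift⁺ a b f) (run-shift⁺ b r)

  run-shift⁻ : ∀ {j b b′ t t′} (as : Vec (Net.T (𝒩 m)) j) →
               Run P (b ∷ t) (map shift as) (b′ ∷ t′) → b ≡ b′ × Run (𝒩 m) t as t′
  run-shift⁻ []       run-[] = refl , run-[]
  run-shift⁻ (a ∷ as) (run-∷ {s' = _ ∷ _} f r) with fires-shift⁻ a f | run-shift⁻ as r
  ... | refl , f′ | refl , r′ = refl , run-∷ f′ r′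

  embed : Bool → ∀ {j} → Raw (𝒩 m) j → Raw P j
  embed b (t , as) = b ∷ t , map shift as

  Q-embed⁺ : ∀ b {j} (y : Raw (𝒩 m) j) → Q (𝒩 m) j y → Q P j (embed b y)
  Q-embed⁺ b (t , as) (ordered , t′ , r) = ordered′ , b ∷ t′ , run-shift⁺ b r
    where
    ordered′ : ∀ i k → i <ᶠ k → (lookup (map shift as) i <ᶠ lookup (map shift as) k)
                                × Indep P (lookup (map shift as) i) (lookup (map shift as) k)
    ordered′ i k i<k rewrite lookup-map i shift as | lookup-map k shift as =
      s≤s (proj₁ (ordered i k i<k)) , Indep-shift⁺ (lookup as i) (lookup as k) (proj₂ (ordered i k i<k))

  Q-embed⁻ : ∀ b {j} (y : Raw (𝒩 m) j) → Q P j (embed b y) → Q (𝒩 m) j y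
  Q-embed⁻ b (t , as) (ordered , _ ∷ t′ , r) = ordered′ , t′ , proj₂ (run-shift⁻ as r)
    where
    ordered′ : ∀ i k → i <ᶠ k → (proj₁ (lookup as i) <ᶠ proj₁ (lookup as k))
                                × Indep (𝒩 m) (lookup as i) (lookup as k)
    ordered′ i k i<k with ordered i k i<k
    ... | shifted< , ind rewrite lookup-map i shift as | lookup-map k shift as =
      s<s⁻¹ shifted< , Indep-shift⁻ (lookup as i) (lookup as k) ind

  embed-∂ : ∀ b {j} (y : Raw (𝒩 m) (suc j)) i ε → embed b (∂ (𝒩 m) i ε y) ≡ ∂ P i ε (embed b y)
  embed-∂ b (t , as) i false = cong (b ∷ t ,_) (sym (map-removeAt shift as i))
  embed-∂ b (t , as) i true rewrite lookup-map i shift as =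
    cong₂ _,_ (sym (act-shift b t (lookup as i))) (sym (map-removeAt shift as i))

  map-shift-injective : ∀ {j} {as as′ : Vec (Net.T (𝒩 m)) j} → map shift as ≡ map shift as′ → as ≡ as′
  map-shift-injective {as = []}     {[]}       _  = refl
  map-shift-injective {as = a ∷ as} {a′ ∷ as′} eq =
    cong₂ _∷_ (shift-injective (cong head eq)) (map-shift-injective (cong tail eq))

  embed-injective : ∀ b {j} {y y′ : Raw (𝒩 m) j} → embed b y ≡ embed b y′ → y ≡ y′
  embed-injective b eq = cong₂ _,_ (cong (tail ∘ proj₁) eq) (map-shift-injective (cong proj₂ eq))

  component : Bool → GSub P
  component b j x = ∃ λ y → Q (𝒩 m) j y × embed b y ≡ x

  Intersection : GSub P
  Intersection j x = ImQ P t₁ j x × ImQ P t₂ j x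

  component-closed : ∀ b → Closed P (component b)
  component-closed b x i ε (y , q , refl) = ∂ (𝒩 m) i ε y , Q-closed (𝒩 m) y i ε q , embed-∂ b y i ε

  component⊆Intersection : ∀ b j x → component b j x → Intersection j x
  component⊆Intersection b j x (y@(t , as) , q , refl) =
    ImQ⁺ P t₁ (Q-embed⁺ b y q) (λ i eq → shift≢t₁ (lookup as i) (trans (sym (lookup-map i shift as)) eq)) ,
    ImQ⁺ P t₂ (Q-embed⁺ b y q) (λ i eq → shift≢t₂ (lookup as i) (trans (sym (lookup-map i shift as)) eq))

  Intersection⇒component : ∀ {j} b t as → Intersection j (b ∷ t , as) → component b j (b ∷ t , as)
  Intersection⇒component {j} b t as (in₁ , in₂) =
    (t , bs) , Q-embed⁻ b (t , bs) (subst (λ cs → Q P j (b ∷ t , cs)) (sym map-shift-bs) q) ,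
    cong (b ∷ t ,_) map-shift-bs
    where
    q : Q P j (b ∷ t , as)
    q = proj₁ (ImQ-isSemicubicalSubset P t₁) j _ in₁
    avoids : ∀ i → lookup as i ≢ t₁ × lookup as i ≢ t₂
    avoids i = ImQ⁻ P t₁ in₁ i , ImQ⁻ P t₂ in₂ i
    bs : Vec (Net.T (𝒩 m)) j
    bs = map (λ (a , a-avoids) → unshift a a-avoids) (restrict as avoids)
    map-shift-bs : map shift bs ≡ as
    map-shift-bs = begin
      map shift bs                              ≡⟨ sym (map-∘ shift _ (restrict as avoids)) ⟩
      map (λ (a , h) → shift (unshift a h)) (restrict as avoids)
                                                ≡⟨ map-cong (λ (a , h) → shift-unshift a h) (restrict as avoids) ⟩
      map proj₁ (restrict as avoids)            ≡⟨ map-proj₁-restrict as avoids ⟩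
      as                                        ∎
      where open ≡-Reasoning

  component-isSemicubicalSubset : ∀ b → IsSemicubicalSubset P (component b) Intersection
  component-isSemicubicalSubset b = component⊆Intersection b , component-closed b

  Intersection⊆components : ∀ j x → Intersection j x → component true j x ⊎ component false j x
  Intersection⊆components j (true  ∷ t , as) h = inj₁ (Intersection⇒component true  t as h)
  Intersection⊆components j (false ∷ t , as) h = inj₂ (Intersection⇒component false t as h)

  components-disjoint : ∀ j x → component true j x → component false j x → ⊥
  components-disjoint j x (_ , _ , refl) (_ , _ , eq) with cong (head ∘ proj₁) eq
  ... | ()

  component≅Q : ∀ b → Iso P (𝒩 m) (component b) (Q (𝒩 m))
  component≅Q b = record
    { to      = λ { _ (_ , y , q , _) → y , q }
    ; from    = λ { _ (y , q) → embed b y , y , q , refl }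
    ; from-to = λ { _ (_ , _ , _ , eq) → eq }
    ; to-from = λ _ _ → refl
    ; to-∂    = λ { _ _ i ε (y , _ , refl) (y′ , _ , eq) → embed-injective b (trans eq (sym (embed-∂ b y i ε))) }
    }

  reachable-cons : ∀ b {t t′} → Reachable (𝒩 m) t t′ → Reachable (𝒩 (suc m)) (b ∷ t) (b ∷ t′)
  reachable-cons b = gmap (b ∷_) λ { (a , f) → (shift a , shift≢t₁ a) , fires-shift⁺ a b f }

  reachable⇒Conn : ∀ b {t t′} → Reachable (𝒩 m) t t′ →
                   Conn P (component b) (0 , (b ∷ t , [])) (0 , (b ∷ t′ , []))
  reachable⇒Conn b Star.ε = c-refl
  reachable⇒Conn b {t} ((a , f@(_ , _ , refl)) ◅ r) =
    c-trans (subst (λ s → Conn P (component b) (0 , (b ∷ t , [])) (0 , (s , [])))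
                   (act-shift b t a)
                   (Conn-edge ((t , a ∷ []) , ((λ { fzero fzero () }) , _ , run-∷ f run-[]) , refl)))
            (reachable⇒Conn b r)

  t₂-moves-token : Fires P (true ∷ ∅) t₂ (false ∷ Net.post (Pipe (suc m)) fzero)
  t₂-moves-token = pointwise⇒fires P {a = t₂} λ { fzero → consume ; (fsuc x) → moved x }
    where
    moved : ∀ x → FiresAt (lookup ∅ x) (lookup (Net.pre P t₂) (fsuc x)) (lookup (Net.post P t₂) (fsuc x))
                          (lookup (Net.post (Pipe (suc m)) fzero) x)
    moved x rewrite lookup-replicate x false | lookup∘tabulate (λ _ → false) x = fill _
      where
      fill : ∀ q → FiresAt false false q q
      fill true  = produce
      fill false = idle

-- Empty the places behind p₁ first; then a token on p₁ is passed on by t₂ and the rest emptied again.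
reachable-∅ : ∀ n (t : Subset n) → Reachable (𝒩 n) t ∅
reachable-∅ zero    []      = Star.ε
reachable-∅ (suc n) (b ∷ t) = reachable-cons b (reachable-∅ n t) ◅◅ drain b
  where
  open Pipeline n
  drain : ∀ b → Reachable (𝒩 (suc n)) (b ∷ ∅) ∅
  drain false = Star.ε
  drain true  = ((t₂ , λ ()) , t₂-moves-token) ◅ reachable-cons false (reachable-∅ n _)

component-connected : ∀ m b → Connected (Pipe (suc (suc m))) (Pipeline.component m b)
component-connected m b = (0 , _ , (∅ , []) , ((λ ()) , _ , run-[]) , refl) , connect
  where
  open Pipeline m
  toBase : ∀ {j} (y : Raw (𝒩 m) j) → Q (𝒩 m) j y →
           Conn P (component b) (j , embed b y) (0 , (b ∷ ∅ , []))
  toBase y@(t , as) q =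
    c-trans (Conn-vertex (component-closed b) (b ∷ t) (map shift as) (y , q , refl))
            (reachable⇒Conn b (reachable-∅ m t))
  connect : ∀ j k x x′ → component b j x → component b k x′ → Conn P (component b) (j , x) (k , x′)
  connect _ _ _ _ (y , q , refl) (y′ , q′ , refl) = c-trans (toBase y q) (c-sym (toBase y′ q′))

mainTheorem2 : (m : ℕ) →
    IsSemicubicalSubset (Pipe (suc (suc m))) (ImQ (Pipe (suc (suc m))) fzero) (Q (Pipe (suc (suc m))))
    × IsSemicubicalSubset (Pipe (suc (suc m))) (ImQ (Pipe (suc (suc m))) (fsuc fzero)) (Q (Pipe (suc (suc m))))
    × (∀ j x → Q (Pipe (suc (suc m))) j x
         → ImQ (Pipe (suc (suc m))) fzero j x ⊎ ImQ (Pipe (suc (suc m))) (fsuc fzero) j x)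
    × Σ (GSub (Pipe (suc (suc m)))) (λ A → Σ (GSub (Pipe (suc (suc m)))) (λ B →
        IsSemicubicalSubset (Pipe (suc (suc m))) A
          (λ j x → ImQ (Pipe (suc (suc m))) fzero j x × ImQ (Pipe (suc (suc m))) (fsuc fzero) j x)
        × IsSemicubicalSubset (Pipe (suc (suc m))) B
          (λ j x → ImQ (Pipe (suc (suc m))) fzero j x × ImQ (Pipe (suc (suc m))) (fsuc fzero) j x)
        × (∀ j x → ImQ (Pipe (suc (suc m))) fzero j x × ImQ (Pipe (suc (suc m))) (fsuc fzero) j x
             → A j x ⊎ B j x)
        × (∀ j x → A j x → B j x → ⊥)
        × Connected (Pipe (suc (suc m))) A
        × Connected (Pipe (suc (suc m))) B
        × Iso (Pipe (suc (suc m))) (𝒩 m) A (Q (𝒩 m))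
        × Iso (Pipe (suc (suc m))) (𝒩 m) B (Q (𝒩 m))))
mainTheorem2 m =
  ImQ-isSemicubicalSubset P t₁ , ImQ-isSemicubicalSubset P t₂ , Q-covered ,
  component true , component false ,
  component-isSemicubicalSubset true , component-isSemicubicalSubset false ,
  Intersection⊆components , components-disjoint ,
  component-connected m true , component-connected m false ,
  component≅Q true , component≅Q false
  where open Pipeline m
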